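{- Let $a\geq1$ be an integer and for integers $b\geq a$, $h\geq0$ let $Q_{a,b}^{(h)}=U^{a+h}D^aU^bD^{b+h}$. Let $\mu$ be the M\"obius function of the Dyck pattern poset. Then: $\mu(UD,Q_{a,a+1}^{(1)})=-1$; $\mu(UD,Q_{a,a+1}^{(0)})=1$; $\mu(UD,Q_{a,a}^{(0)})=-2$ if $a\geq2$, and $\mu(UD,Q_{1,1}^{(0)})=-1$; $\mu(UD,Q_{a,a}^{(1)})=2$ if $a\geq2$, and $\mu(UD,Q_{1,1}^{(1)})=1$.
   Context: A Dyck path is a word over $\{U,D\}$ with equally many $U$'s and $D$'s such that every prefix has at least as many $U$'s as $D$'s. The Dyck pattern poset is the set of nonempty Dyck paths ordered by $P\leq Q$ iff $P$ is a subword of $Q$ (obtained by deleting letters, not necessarily consecutive). $U^a$ denotes $a$ consecutive $U$'s. The M\"obius function is defined by $\mu(x,x)=1$ and $\mu(x,y)=-\sum_{x\leq z<y}\mu(x,z)$ for $x<y$. -}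

module Defs where

open import Data.Nat using (ℕ; zero; suc; _+_)
open import Data.Bool using (Bool; true; false; _∧_; _∨_; not; if_then_else_)
open import Data.List using (List; []; _∷_; _++_; length; map; filter; replicate; foldr)
open import Data.Integer using (ℤ; +_; -_) renaming (_+_ to _+ℤ_)
open import Relation.Nullary using (Dec; yes; no; ¬_)
open import Relation.Nullary.Decidable using (⌊_⌋)
open import Relation.Binary.PropositionalEquality using (_≡_; refl)

data Step : Set where
  U D : Step

_≟S_ : (x y : Step) → Dec (x ≡ y)
U ≟S U = yes refl
U ≟S D = no λ ()
D ≟S U = no λ ()
D ≟S D = yes refl

_==_ : List Step → List Step → Bool
[] == [] = true
[] == (_ ∷ _) = false
(_ ∷ _) == [] = false
(x ∷ xs) == (y ∷ ys) = ⌊ x ≟S y ⌋ ∧ (xs == ys)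

dyckFrom : ℕ → List Step → Bool
dyckFrom zero [] = true
dyckFrom (suc _) [] = false
dyckFrom h (U ∷ w) = dyckFrom (suc h) w
dyckFrom zero (D ∷ w) = false
dyckFrom (suc h) (D ∷ w) = dyckFrom h w

-- Elements of the Dyck pattern poset: NONEMPTY Dyck paths.
isDyck : List Step → Bool
isDyck [] = false
isDyck w@(_ ∷ _) = dyckFrom zero w

-- Subword (scattered subsequence) order: P ≤ Q iff P is obtained from Q
-- by deleting letters.
_≼_ : List Step → List Step → Bool
[] ≼ _ = true
(_ ∷ _) ≼ [] = false
(x ∷ xs) ≼ (y ∷ ys) = ((⌊ x ≟S y ⌋ ∧ (xs ≼ ys)) ∨ ((x ∷ xs) ≼ ys))

subseqs : List Step → List (List Step)
subseqs [] = [] ∷ []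
subseqs (x ∷ xs) = let r = subseqs xs in map (x ∷_) r ++ r

elem : List Step → List (List Step) → Bool
elem w [] = false
elem w (v ∷ vs) = (w == v) ∨ elem w vs

dedup : List (List Step) → List (List Step)
dedup [] = []
dedup (w ∷ ws) = if elem w ws then dedup ws else w ∷ dedup ws

filterB : (List Step → Bool) → List (List Step) → List (List Step)
filterB p [] = []
filterB p (w ∷ ws) = if p w then w ∷ filterB p ws else filterB p ws

halfOpen : List Step → List Step → List (List Step)
halfOpen x y = filterB (λ z → isDyck z ∧ (x ≼ z) ∧ not (z == y)) (dedup (subseqs y))

sumℤ : List ℤ → ℤ
sumℤ = foldr _+ℤ_ (+ 0)

-- Möbius function with fuel; every z in halfOpen x y is a proper subword of
-- y, hence strictly shorter, so fuel = length y + 1 suffices.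
μ-fuel : ℕ → List Step → List Step → ℤ
μ-fuel zero x y = + 0
μ-fuel (suc n) x y =
  if x == y then + 1
  else if (x ≼ y) then - sumℤ (map (μ-fuel n x) (halfOpen x y))
  else + 0

μ : List Step → List Step → ℤ
μ x y = μ-fuel (suc (length y)) x y

UD : List Step
UD = U ∷ D ∷ []

Q : ℕ → ℕ → ℕ → List Step
Q a b h = replicate (a + h) U ++ replicate a D ++ replicate b U ++ replicate (b + h) D

-- Every Dyck subword of U^(a+h) D^a U^b D^(b+h) has at most four runs, so it is a pyramid
-- U^m D^m or a two-peak word Q (j+1) (k+1) h′.  On these shapes we write down a candidate μ̂:
-- 1 on UD, −1 on UUDD, ±Δφ on two-peak words with h′ ∈ {0, 1}, where Δφ is the mixed second
-- difference of φ a b = −[a = b ≥ 1], and 0 otherwise.  It satisfies the recursion defining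
-- μ(UD, −): below any shape other than UD, μ̂ is supported on UD, on UUDD when it embeds, and on
-- two grids of two-peak shapes whose μ̂-sums telescope to φ and −φ, so the sum over each closed
-- interval vanishes.  Hence μ(UD, −) = μ̂ by induction on length, and the theorem is the value
-- of Δφ on and next to the diagonal.
module Submission where

open import Defs
open import Data.Nat using (ℕ; zero; suc; _+_; _≥_; _≤_; _<_; _∸_; z≤n; s≤s)
import Data.Nat.Properties as ℕ
open import Data.Integer using (ℤ; +_; -_) renaming (_+_ to _+ℤ_; _-_ to _-ℤ_)
import Data.Integer.Properties as ℤ
open import Data.Integer.Tactic.RingSolver using (solve-∀)
open import Data.Product using (Σ; _×_; _,_; proj₁; proj₂; map₁)
open import Data.Sum using (_⊎_; inj₁; inj₂)
open import Data.Bool using (Bool; true; false; _∧_; _∨_; not; if_then_else_)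
open import Data.Bool.Properties using (∨-zeroʳ; ∨-assoc; ∧-zeroʳ; if-eta; if-cong)
open import Data.Unit using (⊤)
open import Data.Empty using (⊥-elim)
open import Data.List using (List; []; _∷_; _++_; length; map; replicate; concatMap; downFrom)
open import Data.List.Properties using (++-assoc; ++-identityʳ)
open import Data.List.Relation.Unary.All as All using (All; []; _∷_)
import Data.List.Relation.Unary.All.Properties as All
open import Relation.Nullary using (Dec; yes; no)
open import Relation.Nullary.Decidable using (⌊_⌋)
open import Relation.Binary.PropositionalEquality

∑ : {A : Set} → List A → (A → ℤ) → ℤ
∑ xs F = sumℤ (map F xs)

module _ {A : Set} where

  ∑-++ : (xs ys : List A) (F : A → ℤ) → ∑ (xs ++ ys) F ≡ ∑ xs F +ℤ ∑ ys F
  ∑-++ []       ys F = sym (ℤ.+-identityˡ _)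
  ∑-++ (x ∷ xs) ys F = trans (cong (F x +ℤ_) (∑-++ xs ys F)) (sym (ℤ.+-assoc (F x) _ _))

  ∑-cong : {xs : List A} {F G : A → ℤ} → All (λ x → F x ≡ G x) xs → ∑ xs F ≡ ∑ xs G
  ∑-cong []       = refl
  ∑-cong (e ∷ es) = cong₂ _+ℤ_ e (∑-cong es)

  ∑-cong′ : (xs : List A) {F G : A → ℤ} → (∀ x → F x ≡ G x) → ∑ xs F ≡ ∑ xs G
  ∑-cong′ xs e = ∑-cong (All.universal e xs)

  ∑-zero : {xs : List A} {F : A → ℤ} → All (λ x → F x ≡ + 0) xs → ∑ xs F ≡ + 0
  ∑-zero []       = refl
  ∑-zero (e ∷ es) = cong₂ _+ℤ_ e (∑-zero es)

  ∑-+ : (xs : List A) (F G : A → ℤ) → ∑ xs (λ x → F x +ℤ G x) ≡ ∑ xs F +ℤ ∑ xs G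
  ∑-+ []       F G = refl
  ∑-+ (x ∷ xs) F G = trans (cong (F x +ℤ G x +ℤ_) (∑-+ xs F G)) (interchange (F x) (G x) _ _)
    where
    interchange : ∀ a b c d → (a +ℤ b) +ℤ (c +ℤ d) ≡ (a +ℤ c) +ℤ (b +ℤ d)
    interchange = solve-∀

  ∑-if-zero : (xs : List A) (b : A → Bool) → ∑ xs (λ x → if b x then + 0 else + 0) ≡ + 0
  ∑-if-zero xs b = ∑-zero (All.universal (λ x → if-eta (b x)) xs)

  ∑-neg : (xs : List A) (F : A → ℤ) → ∑ xs (λ x → - F x) ≡ - ∑ xs F
  ∑-neg []       F = refl
  ∑-neg (x ∷ xs) F = trans (cong (- F x +ℤ_) (∑-neg xs F)) (sym (ℤ.neg-distrib-+ (F x) _))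

∑-comm : {A B : Set} (xs : List A) (ys : List B) (H : A → B → ℤ) →
         ∑ xs (λ x → ∑ ys (H x)) ≡ ∑ ys (λ y → ∑ xs (λ x → H x y))
∑-comm []       ys H = sym (∑-zero (All.universal (λ _ → refl) ys))
∑-comm (x ∷ xs) ys H = trans (cong (∑ ys (H x) +ℤ_) (∑-comm xs ys H)) (sym (∑-+ ys (H x) _))

∑-concatMap : {A B : Set} (f : A → List B) (xs : List A) (F : B → ℤ) →
              ∑ (concatMap f xs) F ≡ ∑ xs (λ x → ∑ (f x) F)
∑-concatMap f []       F = refl
∑-concatMap f (x ∷ xs) F = trans (∑-++ (f x) _ F) (cong (∑ (f x) F +ℤ_) (∑-concatMap f xs F))

∑-map : {A B : Set} (f : A → B) (xs : List A) (F : B → ℤ) → ∑ (map f xs) F ≡ ∑ xs (λ x → F (f x))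
∑-map f []       F = refl
∑-map f (x ∷ xs) F = cong (F (f x) +ℤ_) (∑-map f xs F)

∑-telescope : ∀ n (ψ : ℕ → ℤ) → ∑ (downFrom n) (λ k → ψ (suc k) -ℤ ψ k) ≡ ψ n -ℤ ψ 0
∑-telescope zero    ψ = sym (ℤ.+-inverseʳ (ψ 0))
∑-telescope (suc n) ψ = trans (cong (ψ (suc n) -ℤ ψ n +ℤ_) (∑-telescope n ψ)) (cancel (ψ (suc n)) (ψ n) (ψ 0))
  where
  cancel : ∀ a b c → (a -ℤ b) +ℤ (b -ℤ c) ≡ a -ℤ c
  cancel = solve-∀

∑-downFrom-single : ∀ n j (F : ℕ → ℤ) → j < n → (∀ a → a ≢ j → F a ≡ + 0) → ∑ (downFrom n) F ≡ F j
∑-downFrom-single (suc n) j F j<1+n vanish with n Data.Nat.≟ j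
... | yes refl = trans (cong (F n +ℤ_) rest) (ℤ.+-identityʳ (F n))
  where
  rest : ∑ (downFrom n) F ≡ + 0
  rest = ∑-zero (All.applyDownFrom⁺₁ _ n (λ a<n → vanish _ (λ { refl → ℕ.<-irrefl refl a<n })))
... | no n≢j = trans (cong₂ _+ℤ_ (vanish n n≢j) (∑-downFrom-single n j F j<n vanish)) (ℤ.+-identityˡ (F j))
  where
  j<n : j < n
  j<n = ℕ.≤∧≢⇒< (ℕ.≤-pred j<1+n) (λ e → n≢j (sym e))

-- Subwords and heights

_⊑_ : List Step → List Step → Set
v ⊑ w = v ≼ w ≡ true

Dyck : List Step → Set
Dyck w = isDyck w ≡ true

≟S-refl : ∀ x → ⌊ x ≟S x ⌋ ≡ true
≟S-refl U = refl
≟S-refl D = refl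

true≢false : true ≢ false
true≢false ()

∧-true : ∀ {a b} → (a ∧ b) ≡ true → a ≡ true × b ≡ true
∧-true {true} e = refl , e

∨-true : ∀ {a b} → (a ∨ b) ≡ true → a ≡ true ⊎ b ≡ true
∨-true {true}  e = inj₁ refl
∨-true {false} e = inj₂ e

≟S-sound : ∀ x y → ⌊ x ≟S y ⌋ ≡ true → x ≡ y
≟S-sound U U e = refl
≟S-sound D D e = refl

==-refl : ∀ w → (w == w) ≡ true
==-refl []      = refl
==-refl (x ∷ w) rewrite ≟S-refl x = ==-refl w

==-sound : ∀ v w → (v == w) ≡ true → v ≡ w
==-sound [] [] e = refl
==-sound (x ∷ v) (y ∷ w) e with ∧-true {⌊ x ≟S y ⌋} e
... | x≡y , v==w = cong₂ _∷_ (≟S-sound x y x≡y) (==-sound v w v==w)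

==-complete : ∀ v w → v ≢ w → (v == w) ≡ false
==-complete v w v≢w with v == w in eq
... | true  = ⊥-elim (v≢w (==-sound v w eq))
... | false = refl

replicate-+ : ∀ m n (x : Step) → replicate m x ++ replicate n x ≡ replicate (m + n) x
replicate-+ zero    n x = refl
replicate-+ (suc m) n x = cong (x ∷_) (replicate-+ m n x)

⊑-refl : ∀ w → w ⊑ w
⊑-refl []      = refl
⊑-refl (x ∷ w) rewrite ≟S-refl x | ⊑-refl w = refl

⊑-∷ʳ : ∀ w {r} y → w ⊑ r → w ⊑ (y ∷ r)
⊑-∷ʳ []      y e = refl
⊑-∷ʳ (x ∷ w) y e rewrite e = ∨-zeroʳ _

⊑-++ʳ : ∀ w {r} p → w ⊑ r → w ⊑ (p ++ r)
⊑-++ʳ w []      e = e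
⊑-++ʳ w (y ∷ p) e = ⊑-∷ʳ w y (⊑-++ʳ w p e)

⊑-replicate-++ : ∀ {m n} w {r} x → m ≤ n → w ⊑ r → (replicate m x ++ w) ⊑ (replicate n x ++ r)
⊑-replicate-++ {zero}  {n}     w x m≤n       e = ⊑-++ʳ w (replicate n x) e
⊑-replicate-++ {suc m} {suc n} w {r} x (s≤s m≤n) e
  rewrite ≟S-refl x | ⊑-replicate-++ {m} {n} w {r} x m≤n e = refl

⊑-[] : ∀ {w} → w ⊑ [] → w ≡ []
⊑-[] {[]} e = refl

⊑-replicate-++⁻ : ∀ n x {w r} → w ⊑ (replicate n x ++ r) →
                  Σ ℕ λ m → m ≤ n × Σ (List Step) λ w′ → w ≡ replicate m x ++ w′ × w′ ⊑ r
⊑-replicate-++⁻ zero    x {w}     e = zero , z≤n , w , refl , e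
⊑-replicate-++⁻ (suc n) x {[]}    e = zero , z≤n , [] , refl , refl
⊑-replicate-++⁻ (suc n) x {y ∷ w} e with ∨-true {⌊ y ≟S x ⌋ ∧ _} e
... | inj₁ matched with ∧-true {⌊ y ≟S x ⌋} matched
...   | y≡x , rest with ≟S-sound y x y≡x | ⊑-replicate-++⁻ n x {w} rest
...     | refl | m , m≤n , w′ , refl , w′⊑r = suc m , s≤s m≤n , w′ , refl , w′⊑r
⊑-replicate-++⁻ (suc n) x {y ∷ w} e | inj₂ skipped with ⊑-replicate-++⁻ n x {y ∷ w} skipped
... | m , m≤n , w′ , w≡ , w′⊑r = m , ℕ.m≤n⇒m≤1+n m≤n , w′ , w≡ , w′⊑r

⊑⇒≡∨length< : ∀ v w → v ⊑ w → v ≡ w ⊎ length v < length w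
⊑⇒≡∨length< []      []      e = inj₁ refl
⊑⇒≡∨length< []      (x ∷ w) e = inj₂ (s≤s z≤n)
⊑⇒≡∨length< (y ∷ v) (x ∷ w) e with ∨-true {⌊ y ≟S x ⌋ ∧ _} e
... | inj₁ matched with ∧-true {⌊ y ≟S x ⌋} matched
...   | y≡x , v⊑w with ≟S-sound y x y≡x | ⊑⇒≡∨length< v w v⊑w
...     | refl | inj₁ refl = inj₁ refl
...     | refl | inj₂ lt   = inj₂ (s≤s lt)
⊑⇒≡∨length< (y ∷ v) (x ∷ w) e | inj₂ skipped with ⊑⇒≡∨length< (y ∷ v) w skipped
... | inj₁ refl = inj₂ ℕ.≤-refl
... | inj₂ lt   = inj₂ (ℕ.m≤n⇒m≤1+n lt)

dyckFrom-ups : ∀ n h w → dyckFrom h (replicate n U ++ w) ≡ dyckFrom (n + h) w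
dyckFrom-ups zero    h w = refl
dyckFrom-ups (suc n) zero    w = trans (dyckFrom-ups n 1 w) (cong (λ k → dyckFrom k w) (ℕ.+-suc n 0))
dyckFrom-ups (suc n) (suc h) w = trans (dyckFrom-ups n (2 + h) w) (cong (λ k → dyckFrom k w) (ℕ.+-suc n (suc h)))

dyckFrom-downs : ∀ n h w → n ≤ h → dyckFrom h (replicate n D ++ w) ≡ dyckFrom (h ∸ n) w
dyckFrom-downs zero    h       w n≤h       = refl
dyckFrom-downs (suc n) (suc h) w (s≤s n≤h) = dyckFrom-downs n h w n≤h

dyckFrom-downs-below : ∀ n h w → h < n → dyckFrom h (replicate n D ++ w) ≡ false
dyckFrom-downs-below (suc n) zero    w h<n       = refl
dyckFrom-downs-below (suc n) (suc h) w (s≤s h<n) = dyckFrom-downs-below n h w h<n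

dyckFrom-descent : ∀ h → dyckFrom h (replicate h D) ≡ true
dyckFrom-descent zero    = refl
dyckFrom-descent (suc h) = dyckFrom-descent h

dyckFrom-descent⁻ : ∀ d h → dyckFrom h (replicate d D) ≡ true → d ≡ h
dyckFrom-descent⁻ zero    zero    e = refl
dyckFrom-descent⁻ (suc d) (suc h) e = cong suc (dyckFrom-descent⁻ d h e)

-- Dyck words with at most four runs

Runs : Set
Runs = ℕ × ℕ × ℕ × ℕ

fourRuns : Runs → List Step
fourRuns (a , b , c , d) = replicate a U ++ replicate b D ++ replicate c U ++ replicate d D

_≤ᴿ_ : Runs → Runs → Set
(a , b , c , d) ≤ᴿ (a′ , b′ , c′ , d′) = a ≤ a′ × b ≤ b′ × c ≤ c′ × d ≤ d′

≤ᴿ-refl : ∀ r → r ≤ᴿ r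
≤ᴿ-refl _ = ℕ.≤-refl , ℕ.≤-refl , ℕ.≤-refl , ℕ.≤-refl

≤ᴿ-trans : ∀ r r′ r″ → r ≤ᴿ r′ → r′ ≤ᴿ r″ → r ≤ᴿ r″
≤ᴿ-trans _ _ _ (a , b , c , d) (a′ , b′ , c′ , d′) =
  ℕ.≤-trans a a′ , ℕ.≤-trans b b′ , ℕ.≤-trans c c′ , ℕ.≤-trans d d′

⊑-replicate : ∀ {m n} x → m ≤ n → replicate m x ⊑ replicate n x
⊑-replicate {m} {n} x m≤n =
  subst₂ _⊑_ (++-identityʳ (replicate m x)) (++-identityʳ (replicate n x)) (⊑-replicate-++ [] x m≤n refl)

⊑-fourRuns : ∀ r r′ → r ≤ᴿ r′ → fourRuns r ⊑ fourRuns r′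
⊑-fourRuns (a , b , c , d) _ (a≤ , b≤ , c≤ , d≤) =
  ⊑-replicate-++ _ U a≤ (⊑-replicate-++ _ D b≤ (⊑-replicate-++ _ U c≤ (⊑-replicate D d≤)))

⊑-fourRuns⁻ : ∀ r w → w ⊑ fourRuns r → Σ Runs λ r′ → r′ ≤ᴿ r × w ≡ fourRuns r′
⊑-fourRuns⁻ (a , b , c , d) w w⊑
  with ⊑-replicate-++⁻ a U {w} w⊑
... | a′ , a≤ , w₁ , refl , w₁⊑ with ⊑-replicate-++⁻ b D {w₁} w₁⊑
... | b′ , b≤ , w₂ , refl , w₂⊑ with ⊑-replicate-++⁻ c U {w₂} w₂⊑
... | c′ , c≤ , w₃ , refl , w₃⊑
  with ⊑-replicate-++⁻ d D {w₃} (subst (w₃ ⊑_) (sym (++-identityʳ (replicate d D))) w₃⊑)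
... | d′ , d≤ , w₄ , refl , w₄⊑ with ⊑-[] {w₄} w₄⊑
... | refl = (a′ , b′ , c′ , d′) , (a≤ , b≤ , c≤ , d≤) ,
             cong (λ t → replicate a′ U ++ replicate b′ D ++ replicate c′ U ++ t) (++-identityʳ _)

-- pyramid m is U^(m+1) D^(m+1) and twoPeaks j k h is Q (j+1) (k+1) h;
-- together they are the nonempty Dyck words with at most four runs.
data Shape : Set where
  pyramid  : ℕ → Shape
  twoPeaks : ℕ → ℕ → ℕ → Shape

runsOf : Shape → Runs
runsOf (pyramid m)      = suc m , suc m , 0 , 0
runsOf (twoPeaks j k h) = suc j + h , suc j , suc k , suc k + h

word : Shape → List Step
word s = fourRuns (runsOf s)

-- Only two-peak shapes carry run bounds; the pyramids in a support need none.
Bounded : Shape → Runs → Set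
Bounded (pyramid _)        r = ⊤
Bounded s@(twoPeaks _ _ _) r = runsOf s ≤ᴿ r

Bounded-mono : ∀ s {r r′} → r ≤ᴿ r′ → Bounded s r → Bounded s r′
Bounded-mono (pyramid _)        r≤r′ _   = _
Bounded-mono s@(twoPeaks _ _ _) r≤r′ s≤r = ≤ᴿ-trans (runsOf s) _ _ s≤r r≤r′

Dyck⇒dyckFrom : ∀ {w} → Dyck w → dyckFrom 0 w ≡ true
Dyck⇒dyckFrom {_ ∷ _} e = e

word-pyramid : ∀ m → word (pyramid m) ≡ replicate (suc m) U ++ replicate (suc m) D
word-pyramid m = cong (replicate (suc m) U ++_) (++-identityʳ _)

word-dyck : ∀ s → Dyck (word s)
word-dyck (pyramid m) = begin
  dyckFrom 0 (word (pyramid m))                     ≡⟨ dyckFrom-ups (suc m) 0 _ ⟩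
  dyckFrom (suc m + 0) (replicate (suc m) D ++ [])  ≡⟨ dyckFrom-downs (suc m) _ [] (ℕ.m≤m+n (suc m) 0) ⟩
  dyckFrom (suc m + 0 ∸ suc m) []                   ≡⟨ cong (λ h → dyckFrom h []) (ℕ.m+n∸m≡n (suc m) 0) ⟩
  true                                              ∎
  where open ≡-Reasoning
word-dyck (twoPeaks j k h) = begin
  dyckFrom 0 (word (twoPeaks j k h))
    ≡⟨ dyckFrom-ups (suc j + h) 0 _ ⟩
  dyckFrom (suc j + h + 0) (replicate (suc j) D ++ replicate (suc k) U ++ replicate (suc k + h) D)
    ≡⟨ dyckFrom-downs (suc j) _ _ (ℕ.≤-trans (ℕ.m≤m+n (suc j) h) (ℕ.m≤m+n _ 0)) ⟩
  dyckFrom (suc j + h + 0 ∸ suc j) (replicate (suc k) U ++ replicate (suc k + h) D)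
    ≡⟨ dyckFrom-ups (suc k) (suc j + h + 0 ∸ suc j) (replicate (suc k + h) D) ⟩
  dyckFrom (suc k + (suc j + h + 0 ∸ suc j)) (replicate (suc k + h) D)
    ≡⟨ cong (λ t → dyckFrom (suc k + (t ∸ suc j)) (replicate (suc k + h) D)) (ℕ.+-identityʳ (suc j + h)) ⟩
  dyckFrom (suc k + (suc j + h ∸ suc j)) (replicate (suc k + h) D)
    ≡⟨ cong (λ t → dyckFrom (suc k + t) (replicate (suc k + h) D)) (ℕ.m+n∸m≡n (suc j) h) ⟩
  dyckFrom (suc k + h) (replicate (suc k + h) D)
    ≡⟨ dyckFrom-descent (suc k + h) ⟩
  true ∎
  where open ≡-Reasoning

Dyck-ups⁻ : ∀ a w → Dyck (replicate a U ++ w) → dyckFrom a w ≡ true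
Dyck-ups⁻ a w dy =
  trans (sym (trans (dyckFrom-ups a 0 w) (cong (λ h → dyckFrom h w) (ℕ.+-identityʳ a))))
        (Dyck⇒dyckFrom {replicate a U ++ w} dy)

pyramid-runs : ∀ a e → Dyck (replicate a U ++ replicate e D) → Σ ℕ λ m → a ≡ suc m × e ≡ suc m
pyramid-runs zero    zero    ()
pyramid-runs zero    (suc e) ()
pyramid-runs (suc m) e dy = m , refl , dyckFrom-descent⁻ e (suc m) (Dyck-ups⁻ (suc m) _ dy)

twoPeaks-runs : ∀ a j k d → Dyck (fourRuns (a , suc j , suc k , d)) → Σ ℕ λ h → a ≡ suc j + h × d ≡ suc k + h
twoPeaks-runs a j k d dy with suc j ℕ.≤? a
... | no  j≮a = ⊥-elim (true≢false (trans (sym (Dyck-ups⁻ a _ dy)) (dyckFrom-downs-below (suc j) a _ (ℕ.≰⇒> j≮a))))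
... | yes j<a = a ∸ suc j , sym (ℕ.m+[n∸m]≡n j<a) , dyckFrom-descent⁻ d _ (begin
  dyckFrom (suc k + (a ∸ suc j)) (replicate d D)                    ≡⟨ dyckFrom-ups (suc k) (a ∸ suc j) _ ⟨
  dyckFrom (a ∸ suc j) (replicate (suc k) U ++ replicate d D)       ≡⟨ dyckFrom-downs (suc j) a _ j<a ⟨
  dyckFrom a (replicate (suc j) D ++ replicate (suc k) U ++ replicate d D) ≡⟨ Dyck-ups⁻ a _ dy ⟩
  true ∎)
  where open ≡-Reasoning

fourRuns-merge-D : ∀ a b d → fourRuns (a , b , 0 , d) ≡ replicate a U ++ replicate (b + d) D
fourRuns-merge-D a b d = cong (replicate a U ++_) (replicate-+ b d D)

fourRuns-merge-U : ∀ a c d → fourRuns (a , 0 , c , d) ≡ replicate (a + c) U ++ replicate d D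
fourRuns-merge-U a c d =
  trans (sym (++-assoc (replicate a U) _ _)) (cong (_++ replicate d D) (replicate-+ a c U))

pyramid-shape : ∀ a e → Dyck (replicate a U ++ replicate e D) →
                Σ ℕ λ m → replicate a U ++ replicate e D ≡ word (pyramid m)
pyramid-shape a e dy with pyramid-runs a e dy
... | m , refl , refl = m , sym (word-pyramid m)

fourRuns-shape : ∀ r → Dyck (fourRuns r) → Σ Shape λ s → fourRuns r ≡ word s × Bounded s r
fourRuns-shape (a , b , zero , d) dy
  with pyramid-shape a (b + d) (subst Dyck (fourRuns-merge-D a b d) dy)
... | m , eq = pyramid m , trans (fourRuns-merge-D a b d) eq , _
fourRuns-shape (a , zero , suc k , d) dy
  with pyramid-shape (a + suc k) d (subst Dyck (fourRuns-merge-U a (suc k) d) dy)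
... | m , eq = pyramid m , trans (fourRuns-merge-U a (suc k) d) eq , _
fourRuns-shape (a , suc j , suc k , d) dy with twoPeaks-runs a j k d dy
... | h , refl , refl = twoPeaks j k h , refl , ≤ᴿ-refl _

dyck-subword-shape : ∀ r w → Dyck w → w ⊑ fourRuns r → Σ Shape λ s → w ≡ word s × Bounded s r
dyck-subword-shape r w dy w⊑ with ⊑-fourRuns⁻ r w w⊑
... | r′ , r′≤r , refl with fourRuns-shape r′ dy
... | s , eq , bounded = s , eq , Bounded-mono s r′≤r bounded

run : Step → List Step → ℕ × List Step
run U (U ∷ w) = map₁ suc (run U w)
run D (D ∷ w) = map₁ suc (run D w)
run _ w       = 0 , w

run-replicate : ∀ n x w → run x (replicate n x ++ w) ≡ map₁ (λ m → n + m) (run x w)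
run-replicate zero    x w = refl
run-replicate (suc n) U w = cong (map₁ suc) (run-replicate n U w)
run-replicate (suc n) D w = cong (map₁ suc) (run-replicate n D w)

shapeOfRuns : ℕ → ℕ → ℕ → Shape
shapeOfRuns a b       zero    = pyramid (a ∸ 1)
shapeOfRuns a zero    (suc k) = pyramid 0   -- junk: a U-run is never followed by U's
shapeOfRuns a (suc j) (suc k) = twoPeaks j k (a ∸ suc j)

decode : List Step → Shape
decode w = shapeOfRuns (proj₁ (run U w))
                       (proj₁ (run D (proj₂ (run U w))))
                       (proj₁ (run U (proj₂ (run D (proj₂ (run U w))))))

decode-pyramid : ∀ a b → decode (fourRuns (a , suc b , 0 , 0)) ≡ pyramid (a ∸ 1)
decode-pyramid a b
  rewrite run-replicate a U (replicate (suc b) D ++ []) | run-replicate b D []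
        | ℕ.+-identityʳ a = refl

decode-twoPeaks : ∀ a j k d → decode (fourRuns (a , suc j , suc k , suc d)) ≡ twoPeaks j k (a ∸ suc j)
decode-twoPeaks a j k d
  rewrite run-replicate a U (replicate (suc j) D ++ replicate (suc k) U ++ replicate (suc d) D)
        | run-replicate j D (replicate (suc k) U ++ replicate (suc d) D)
        | run-replicate k U (replicate (suc d) D)
        | ℕ.+-identityʳ a | ℕ.+-identityʳ j | ℕ.+-identityʳ k = refl

decode-word : ∀ s → decode (word s) ≡ s
decode-word (pyramid m)      = decode-pyramid (suc m) m
decode-word (twoPeaks j k h) =
  trans (decode-twoPeaks (suc j + h) j k (k + h)) (cong (twoPeaks j k) (ℕ.m+n∸m≡n (suc j) h))

word-injective : ∀ s t → word s ≡ word t → s ≡ t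
word-injective s t eq = trans (sym (decode-word s)) (trans (cong decode eq) (decode-word t))

_≟ˢ_ : (s t : Shape) → Dec (s ≡ t)
pyramid m ≟ˢ pyramid m′ with m Data.Nat.≟ m′
... | yes refl = yes refl
... | no  m≢m′ = no λ { refl → m≢m′ refl }
pyramid _ ≟ˢ twoPeaks _ _ _ = no λ ()
twoPeaks _ _ _ ≟ˢ pyramid _ = no λ ()
twoPeaks j k h ≟ˢ twoPeaks j′ k′ h′ with j Data.Nat.≟ j′ | k Data.Nat.≟ k′ | h Data.Nat.≟ h′
... | yes refl | yes refl | yes refl = yes refl
... | no  j≢j′ | _        | _        = no λ { refl → j≢j′ refl }
... | yes _    | no  k≢k′ | _        = no λ { refl → k≢k′ refl }
... | yes _    | yes _    | no  h≢h′ = no λ { refl → h≢h′ refl }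

word-== : ∀ s t → (word s == word t) ≡ ⌊ s ≟ˢ t ⌋
word-== s t with s ≟ˢ t
... | yes refl = ==-refl (word s)
... | no  s≢t  = ==-complete (word s) (word t) (λ eq → s≢t (word-injective s t eq))

-- The candidate values μ̂

φ : ℕ → ℕ → ℤ
φ (suc zero)    (suc zero)    = - + 1
φ (suc (suc a)) (suc (suc b)) = φ (suc a) (suc b)
φ _             _             = + 0

φ-diag : ∀ n → φ (suc n) (suc n) ≡ - + 1
φ-diag zero    = refl
φ-diag (suc n) = φ-diag n

φ-off : ∀ a b → a ≢ b → φ a b ≡ + 0
φ-off zero          b             a≢b = refl
φ-off (suc zero)    zero          a≢b = refl
φ-off (suc (suc a)) zero          a≢b = refl
φ-off (suc zero)    (suc zero)    a≢b = ⊥-elim (a≢b refl)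
φ-off (suc zero)    (suc (suc b)) a≢b = refl
φ-off (suc (suc a)) (suc zero)    a≢b = refl
φ-off (suc (suc a)) (suc (suc b)) a≢b = φ-off (suc a) (suc b) (λ e → a≢b (cong suc e))

φ-zeroʳ : ∀ a → φ a 0 ≡ + 0
φ-zeroʳ zero          = refl
φ-zeroʳ (suc zero)    = refl
φ-zeroʳ (suc (suc a)) = refl

φ-shift : ∀ j k → (1 ≤ j ⊎ 1 ≤ k) → φ (suc j) (suc k) ≡ φ j k
φ-shift zero    zero    (inj₁ ())
φ-shift zero    zero    (inj₂ ())
φ-shift zero    (suc k) _ = refl
φ-shift (suc j) zero    _ = sym (φ-zeroʳ (suc j))
φ-shift (suc j) (suc k) _ = refl

Δφ : ℕ → ℕ → ℤ
Δφ j k = (φ (suc j) (suc k) -ℤ φ j (suc k)) -ℤ (φ (suc j) k -ℤ φ j k)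

μ̂ : Shape → ℤ
μ̂ (pyramid 0)                  = + 1
μ̂ (pyramid 1)                  = - + 1
μ̂ (pyramid (suc (suc _)))      = + 0
μ̂ (twoPeaks j k 0)             = Δφ j k
μ̂ (twoPeaks j k 1)             = - Δφ j k
μ̂ (twoPeaks j k (suc (suc _))) = + 0

grid : ℕ → ℕ → ℕ → List Shape
grid n m h = concatMap (λ a → map (λ b → twoPeaks a b h) (downFrom m)) (downFrom n)

∑-grid : ∀ n m h (F : Shape → ℤ) →
         ∑ (grid n m h) F ≡ ∑ (downFrom n) (λ a → ∑ (downFrom m) (λ b → F (twoPeaks a b h)))
∑-grid n m h F = trans (∑-concatMap _ (downFrom n) F) (∑-cong′ (downFrom n) (λ a → ∑-map _ (downFrom m) F))

∑-grid₀-μ̂ : ∀ n m → ∑ (grid n m 0) μ̂ ≡ φ n m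
∑-grid₀-μ̂ n m = begin
  ∑ (grid n m 0) μ̂                                             ≡⟨ ∑-grid n m 0 μ̂ ⟩
  ∑ (downFrom n) (λ a → ∑ (downFrom m) (Δφ a))                 ≡⟨ ∑-cong′ (downFrom n) inner ⟩
  ∑ (downFrom n) (λ a → φ (suc a) m -ℤ φ a m)                  ≡⟨ ∑-telescope n (λ a → φ a m) ⟩
  φ n m -ℤ + 0                                                 ≡⟨ ℤ.+-identityʳ (φ n m) ⟩
  φ n m                                                        ∎
  where
  open ≡-Reasoning
  inner : ∀ a → ∑ (downFrom m) (Δφ a) ≡ φ (suc a) m -ℤ φ a m
  inner a = begin
    ∑ (downFrom m) (Δφ a)                                      ≡⟨ ∑-telescope m (λ b → φ (suc a) b -ℤ φ a b) ⟩
    (φ (suc a) m -ℤ φ a m) -ℤ (φ (suc a) 0 -ℤ φ a 0)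
      ≡⟨ cong₂ (λ p q → (φ (suc a) m -ℤ φ a m) -ℤ (p -ℤ q)) (φ-zeroʳ (suc a)) (φ-zeroʳ a) ⟩
    (φ (suc a) m -ℤ φ a m) -ℤ + 0                              ≡⟨ ℤ.+-identityʳ _ ⟩
    φ (suc a) m -ℤ φ a m                                       ∎

∑-grid₁-μ̂ : ∀ n m → ∑ (grid n m 1) μ̂ ≡ - φ n m
∑-grid₁-μ̂ n m = begin
  ∑ (grid n m 1) μ̂                                             ≡⟨ ∑-grid n m 1 μ̂ ⟩
  ∑ (downFrom n) (λ a → ∑ (downFrom m) (λ b → - Δφ a b))
    ≡⟨ ∑-cong′ (downFrom n) (λ a → ∑-neg (downFrom m) (Δφ a)) ⟩
  ∑ (downFrom n) (λ a → - ∑ (downFrom m) (Δφ a))               ≡⟨ ∑-neg (downFrom n) _ ⟩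
  - ∑ (downFrom n) (λ a → ∑ (downFrom m) (Δφ a))
    ≡⟨ cong -_ (trans (sym (∑-grid n m 0 μ̂)) (∑-grid₀-μ̂ n m)) ⟩
  - φ n m                                                      ∎
  where open ≡-Reasoning

-- The support of μ̂ below a shape

≟ˢ-refl : ∀ t → ⌊ t ≟ˢ t ⌋ ≡ true
≟ˢ-refl t with t ≟ˢ t
... | yes _   = refl
... | no  t≢t = ⊥-elim (t≢t refl)

≟ˢ-≢ : ∀ u t → u ≢ t → ⌊ u ≟ˢ t ⌋ ≡ false
≟ˢ-≢ u t u≢t with u ≟ˢ t
... | yes u≡t = ⊥-elim (u≢t u≡t)
... | no  _   = refl

indicator : Shape → ℤ → Shape → ℤ
indicator t x u = if ⌊ u ≟ˢ t ⌋ then x else + 0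

record Once (ts : List Shape) (t : Shape) : Set where
  constructor once
  field count : ∀ x → ∑ ts (indicator t x) ≡ x

∑-absent : ∀ {ts t} x → All (_≢ t) ts → ∑ ts (indicator t x) ≡ + 0
∑-absent {t = t} x absent = ∑-zero (All.map (λ {u} u≢t → if-cong (≟ˢ-≢ u t u≢t)) absent)

once-here : ∀ t {ts} → All (_≢ t) ts → Once (t ∷ ts) t
once-here t absent = once λ x → trans (cong₂ _+ℤ_ (if-cong (≟ˢ-refl t)) (∑-absent x absent)) (ℤ.+-identityʳ x)

once-there : ∀ u {t ts} → u ≢ t → Once ts t → Once (u ∷ ts) t
once-there u {t} u≢t (once count) =
  once λ x → trans (cong₂ _+ℤ_ (if-cong (≟ˢ-≢ u t u≢t)) (count x)) (ℤ.+-identityˡ x)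

once-++ˡ : ∀ ts us {t} → Once ts t → All (_≢ t) us → Once (ts ++ us) t
once-++ˡ ts us (once count) absent =
  once λ x → trans (∑-++ ts us _) (trans (cong₂ _+ℤ_ (count x) (∑-absent x absent)) (ℤ.+-identityʳ x))

once-++ʳ : ∀ ts us {t} → All (_≢ t) ts → Once us t → Once (ts ++ us) t
once-++ʳ ts us absent (once count) =
  once λ x → trans (∑-++ ts us _) (trans (cong₂ _+ℤ_ (∑-absent x absent) (count x)) (ℤ.+-identityˡ x))

grid-All : ∀ {P : Shape → Set} n m h → (∀ {a b} → a < n → b < m → P (twoPeaks a b h)) → All P (grid n m h)
grid-All n m h p =
  All.concat⁺ (All.map⁺ (All.applyDownFrom⁺₁ _ n (λ a<n → All.map⁺ (All.applyDownFrom⁺₁ _ m (p a<n)))))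

once-grid : ∀ {n m a b} h → a < n → b < m → Once (grid n m h) (twoPeaks a b h)
once-grid {n} {m} {a} {b} h a<n b<m = once count
  where
  open ≡-Reasoning
  count : ∀ x → ∑ (grid n m h) (indicator (twoPeaks a b h) x) ≡ x
  count x = begin
    ∑ (grid n m h) δ                                                   ≡⟨ ∑-grid n m h δ ⟩
    ∑ (downFrom n) (λ a′ → ∑ (downFrom m) (λ b′ → δ (twoPeaks a′ b′ h)))
      ≡⟨ ∑-downFrom-single n a _ a<n (λ a′ a′≢a → ∑-zero (All.universal (λ _ → off a′≢a) (downFrom m))) ⟩
    ∑ (downFrom m) (λ b′ → δ (twoPeaks a b′ h))
      ≡⟨ ∑-downFrom-single m b _ b<m (λ _ → off′) ⟩
    δ (twoPeaks a b h)                                                 ≡⟨ if-cong (≟ˢ-refl (twoPeaks a b h)) ⟩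
    x                                                                  ∎
    where
    δ : Shape → ℤ
    δ = indicator (twoPeaks a b h) x
    off : ∀ {a′ b′} → a′ ≢ a → δ (twoPeaks a′ b′ h) ≡ + 0
    off {a′} {b′} a′≢a = if-cong (≟ˢ-≢ (twoPeaks a′ b′ h) (twoPeaks a b h) λ { refl → a′≢a refl })
    off′ : ∀ {b′} → b′ ≢ b → δ (twoPeaks a b′ h) ≡ + 0
    off′ {b′} b′≢b = if-cong (≟ˢ-≢ (twoPeaks a b′ h) (twoPeaks a b h) λ { refl → b′≢b refl })

UD⊑word : ∀ s → UD ⊑ word s
UD⊑word s@(pyramid _)      = ⊑-fourRuns (1 , 1 , 0 , 0) (runsOf s) (s≤s z≤n , s≤s z≤n , z≤n , z≤n)
UD⊑word s@(twoPeaks _ _ _) = ⊑-fourRuns (1 , 1 , 0 , 0) (runsOf s) (s≤s z≤n , s≤s z≤n , z≤n , z≤n)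

-- twoPeaks a b 1 ⊑ twoPeaks j k h exactly when a < bound₁ j h and b < bound₁ k h.
bound₁ : ℕ → ℕ → ℕ
bound₁ j zero    = j
bound₁ j (suc _) = suc j

<bound₁ : ∀ {a j} h → suc a + 1 ≤ suc j + h → a < suc j → a < bound₁ j h
<bound₁ {a} {j} zero    a+2≤j+1 _   = ℕ.≤-pred (subst₂ _≤_ (ℕ.+-comm (suc a) 1) (ℕ.+-identityʳ (suc j)) a+2≤j+1)
<bound₁         (suc h) _       a≤j = a≤j

bound₁-< : ∀ {a j} h → a < bound₁ j h → suc a + 1 ≤ suc j + h × a < suc j
bound₁-< {a} {j} zero    a<j =
  subst₂ _≤_ (ℕ.+-comm 1 (suc a)) (sym (ℕ.+-identityʳ (suc j))) (s≤s a<j) , ℕ.m≤n⇒m≤1+n a<j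
bound₁-< {a} {j} (suc h) a≤j = ℕ.+-mono-≤ a≤j (s≤s z≤n) , a≤j

pyramid₁-if-below : Shape → List Shape
pyramid₁-if-below s = if word (pyramid 1) ≼ word s then pyramid 1 ∷ [] else []

pyramidSupport : Shape → List Shape
pyramidSupport s = pyramid 0 ∷ pyramid₁-if-below s

twoPeaksSupport : Shape → List Shape
twoPeaksSupport (pyramid _)      = []
twoPeaksSupport (twoPeaks j k h) = grid (suc j) (suc k) 0 ++ grid (bound₁ j h) (bound₁ k h) 1

-- The shapes below s on which μ̂ may be nonzero, each listed once.
support : Shape → List Shape
support s = pyramidSupport s ++ twoPeaksSupport s

pyramid₁-if-below-All : ∀ {P : Shape → Set} s → P (pyramid 1) → All P (pyramid₁-if-below s)
pyramid₁-if-below-All s p₁ with word (pyramid 1) ≼ word s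
... | true  = p₁ ∷ []
... | false = []

pyramidSupport-All : ∀ {P : Shape → Set} s → P (pyramid 0) → P (pyramid 1) → All P (pyramidSupport s)
pyramidSupport-All s p₀ p₁ = p₀ ∷ pyramid₁-if-below-All s p₁

pyramidSupport-⊒pyramid₁ : ∀ s → word (pyramid 1) ⊑ word s → pyramidSupport s ≡ pyramid 0 ∷ pyramid 1 ∷ []
pyramidSupport-⊒pyramid₁ s p₁⊑s rewrite p₁⊑s = refl

grid-level-absent : ∀ n m {h h′} a b → h ≢ h′ → All (_≢ twoPeaks a b h′) (grid n m h)
grid-level-absent n m {h} a b h≢h′ = grid-All n m h (λ _ _ → λ { refl → h≢h′ refl })

twoPeaksSupport-pyramid-absent : ∀ s p → All (_≢ pyramid p) (twoPeaksSupport s)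
twoPeaksSupport-pyramid-absent (pyramid _)      p = []
twoPeaksSupport-pyramid-absent (twoPeaks j k h) p =
  All.++⁺ (grid-All (suc j) (suc k) 0 λ _ _ ()) (grid-All (bound₁ j h) (bound₁ k h) 1 λ _ _ ())

support-below : ∀ s → All (λ t → word t ⊑ word s) (support s)
support-below s = All.++⁺ pyramids (twoPeaksPart s)
  where
  pyramids : All (λ t → word t ⊑ word s) (pyramidSupport s)
  pyramids with word (pyramid 1) ≼ word s in p₁⊑s
  ... | true  = UD⊑word s ∷ p₁⊑s ∷ []
  ... | false = UD⊑word s ∷ []
  twoPeaksPart : ∀ s → All (λ t → word t ⊑ word s) (twoPeaksSupport s)
  twoPeaksPart (pyramid _)      = []
  twoPeaksPart (twoPeaks j k h) = All.++⁺
    (grid-All (suc j) (suc k) 0 λ {a} {b} a<j b<k →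
      ⊑-fourRuns (runsOf (twoPeaks a b 0)) (runsOf (twoPeaks j k h)) (level₀ a<j , a<j , b<k , level₀ b<k))
    (grid-All (bound₁ j h) (bound₁ k h) 1 λ {a} {b} a<j b<k →
      let (a₁ , a≤) = bound₁-< h a<j ; (b₁ , b≤) = bound₁-< h b<k
      in ⊑-fourRuns (runsOf (twoPeaks a b 1)) (runsOf (twoPeaks j k h)) (a₁ , a≤ , b≤ , b₁))
    where
    level₀ : ∀ {a j} → a < suc j → suc a + 0 ≤ suc j + h
    level₀ {a} a<j = ℕ.≤-trans (ℕ.≤-reflexive (ℕ.+-identityʳ (suc a))) (ℕ.≤-trans a<j (ℕ.m≤m+n _ h))

∑-twoPeaksSupport-μ̂ : ∀ j k h →
  ∑ (twoPeaksSupport (twoPeaks j k h)) μ̂ ≡ φ (suc j) (suc k) -ℤ φ (bound₁ j h) (bound₁ k h)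
∑-twoPeaksSupport-μ̂ j k h =
  trans (∑-++ (grid (suc j) (suc k) 0) _ μ̂)
        (cong₂ _+ℤ_ (∑-grid₀-μ̂ (suc j) (suc k)) (∑-grid₁-μ̂ (bound₁ j h) (bound₁ k h)))

∑-support-twoPeaks-μ̂ : ∀ j k h → word (pyramid 1) ⊑ word (twoPeaks j k h) →
  φ (bound₁ j h) (bound₁ k h) ≡ φ (suc j) (suc k) → ∑ (support (twoPeaks j k h)) μ̂ ≡ + 0
∑-support-twoPeaks-μ̂ j k h p₁⊑s φ-bound = begin
  ∑ (support s) μ̂                                              ≡⟨ ∑-++ (pyramidSupport s) _ μ̂ ⟩
  ∑ (pyramidSupport s) μ̂ +ℤ ∑ (twoPeaksSupport s) μ̂
    ≡⟨ cong₂ _+ℤ_ pyramids (∑-twoPeaksSupport-μ̂ j k h) ⟩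
  + 0 +ℤ (φ (suc j) (suc k) -ℤ φ (bound₁ j h) (bound₁ k h))     ≡⟨ ℤ.+-identityˡ _ ⟩
  φ (suc j) (suc k) -ℤ φ (bound₁ j h) (bound₁ k h)              ≡⟨ cong (φ (suc j) (suc k) -ℤ_) φ-bound ⟩
  φ (suc j) (suc k) -ℤ φ (suc j) (suc k)                        ≡⟨ ℤ.+-inverseʳ (φ (suc j) (suc k)) ⟩
  + 0                                                           ∎
  where
  open ≡-Reasoning
  s : Shape
  s = twoPeaks j k h
  pyramids : ∑ (pyramidSupport s) μ̂ ≡ + 0
  pyramids = cong (λ ts → ∑ ts μ̂) (pyramidSupport-⊒pyramid₁ s p₁⊑s)

∑-support-μ̂ : ∀ s → s ≢ pyramid 0 → ∑ (support s) μ̂ ≡ + 0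
∑-support-μ̂ (pyramid zero) s≢UD = ⊥-elim (s≢UD refl)
∑-support-μ̂ s@(pyramid (suc m)) _ =
  cong (λ ts → ∑ (ts ++ []) μ̂) (pyramidSupport-⊒pyramid₁ s
    (⊑-fourRuns (2 , 2 , 0 , 0) (runsOf s) (s≤s (s≤s z≤n) , s≤s (s≤s z≤n) , z≤n , z≤n)))
∑-support-μ̂ (twoPeaks zero zero zero) _ = refl   -- UDUD: UUDD does not embed, and μ̂ = −1
-- fourRuns (2 , 1 , 0 , 1) and fourRuns (1 , 0 , 1 , 2) are UUDD as well.
∑-support-μ̂ s@(twoPeaks j k (suc h)) _ =
  ∑-support-twoPeaks-μ̂ j k (suc h)
    (⊑-fourRuns (2 , 1 , 0 , 1) (runsOf s)
      (s≤s (ℕ.≤-trans (s≤s z≤n) (ℕ.m≤n+m (suc h) j)) , s≤s z≤n , z≤n , s≤s z≤n))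
    refl
∑-support-μ̂ s@(twoPeaks (suc j) k zero) _ =
  ∑-support-twoPeaks-μ̂ (suc j) k zero
    (⊑-fourRuns (2 , 2 , 0 , 0) (runsOf s) (s≤s (s≤s z≤n) , s≤s (s≤s z≤n) , z≤n , z≤n))
    (sym (φ-shift (suc j) k (inj₁ (s≤s z≤n))))
∑-support-μ̂ s@(twoPeaks zero (suc k) zero) _ =
  ∑-support-twoPeaks-μ̂ zero (suc k) zero
    (⊑-fourRuns (1 , 0 , 1 , 2) (runsOf s) (s≤s z≤n , z≤n , s≤s z≤n , s≤s (s≤s z≤n)))
    (sym (φ-shift zero (suc k) (inj₂ (s≤s z≤n))))

support-once : ∀ s t → Bounded t (runsOf s) → word t ⊑ word s → μ̂ t ≡ + 0 ⊎ Once (support s) t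
support-once s (pyramid 0) _ _ =
  inj₂ (once-++ˡ (pyramidSupport s) (twoPeaksSupport s)
         (once-here (pyramid 0) (pyramid₁-if-below-All s (λ ())))
         (twoPeaksSupport-pyramid-absent s 0))
support-once s (pyramid 1) _ p₁⊑s =
  inj₂ (subst (λ ts → Once (ts ++ twoPeaksSupport s) (pyramid 1)) (sym (pyramidSupport-⊒pyramid₁ s p₁⊑s))
         (once-++ˡ (pyramid 0 ∷ pyramid 1 ∷ []) (twoPeaksSupport s)
           (once-there (pyramid 0) (λ ()) (once-here (pyramid 1) []))
           (twoPeaksSupport-pyramid-absent s 1)))
support-once s (pyramid (suc (suc _))) _ _ = inj₁ refl
support-once (pyramid _) (twoPeaks _ _ _) (_ , _ , () , _) _
support-once s@(twoPeaks j k h) (twoPeaks a b 0) (_ , a<j , b<k , _) _ =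
  inj₂ (once-++ʳ (pyramidSupport s) (twoPeaksSupport s) (pyramidSupport-All s (λ ()) (λ ()))
         (once-++ˡ grid₀ grid₁ (once-grid 0 a<j b<k) (grid-level-absent (bound₁ j h) (bound₁ k h) a b (λ ()))))
  where
  grid₀ grid₁ : List Shape
  grid₀ = grid (suc j) (suc k) 0
  grid₁ = grid (bound₁ j h) (bound₁ k h) 1
support-once s@(twoPeaks j k h) (twoPeaks a b 1) (a₁ , a<j , b<k , b₁) _ =
  inj₂ (once-++ʳ (pyramidSupport s) (twoPeaksSupport s) (pyramidSupport-All s (λ ()) (λ ()))
         (once-++ʳ grid₀ grid₁ (grid-level-absent (suc j) (suc k) a b (λ ()))
           (once-grid 1 (<bound₁ h a₁ a<j) (<bound₁ h b₁ b<k))))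
  where
  grid₀ grid₁ : List Shape
  grid₀ = grid (suc j) (suc k) 0
  grid₁ = grid (bound₁ j h) (bound₁ k h) 1
support-once s (twoPeaks _ _ (suc (suc _))) _ _ = inj₁ refl

-- μ̂ satisfies the recursion of μ(UD, −)

∑-filterB : ∀ p X (F : List Step → ℤ) → ∑ (filterB p X) F ≡ ∑ X (λ w → if p w then F w else + 0)
∑-filterB p []      F = refl
∑-filterB p (w ∷ X) F with p w
... | true  = cong (F w +ℤ_) (∑-filterB p X F)
... | false = trans (∑-filterB p X F) (sym (ℤ.+-identityˡ _))

elem-members : ∀ X → All (λ w → elem w X ≡ true) X
elem-members []      = []
elem-members (x ∷ X) =
  cong (_∨ elem x X) (==-refl x) ∷ All.map (λ {w} e → trans (cong ((w == x) ∨_) e) (∨-zeroʳ _)) (elem-members X)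

elem-++ : ∀ v xs ys → elem v (xs ++ ys) ≡ (elem v xs ∨ elem v ys)
elem-++ v []       ys = refl
elem-++ v (x ∷ xs) ys = trans (cong ((v == x) ∨_) (elem-++ v xs ys)) (sym (∨-assoc (v == x) _ _))

elem-[]-map-∷ : ∀ x r → elem [] (map (x ∷_) r) ≡ false
elem-[]-map-∷ x []      = refl
elem-[]-map-∷ x (_ ∷ r) = elem-[]-map-∷ x r

elem-∷-map-∷ : ∀ y ys x r → elem (y ∷ ys) (map (x ∷_) r) ≡ (⌊ y ≟S x ⌋ ∧ elem ys r)
elem-∷-map-∷ y ys x []      = sym (∧-zeroʳ _)
elem-∷-map-∷ y ys x (w ∷ r) rewrite elem-∷-map-∷ y ys x r with ⌊ y ≟S x ⌋
... | true  = refl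
... | false = refl

elem-subseqs : ∀ v z → elem v (subseqs z) ≡ v ≼ z
elem-subseqs []       []       = refl
elem-subseqs (y ∷ ys) []       = refl
elem-subseqs []       (x ∷ xs)
  rewrite elem-++ [] (map (x ∷_) (subseqs xs)) (subseqs xs) | elem-[]-map-∷ x (subseqs xs) = elem-subseqs [] xs
elem-subseqs (y ∷ ys) (x ∷ xs)
  rewrite elem-++ (y ∷ ys) (map (x ∷_) (subseqs xs)) (subseqs xs) | elem-∷-map-∷ y ys x (subseqs xs)
        | elem-subseqs ys xs | elem-subseqs (y ∷ ys) xs = refl

elem-dedup : ∀ v Y → elem v (dedup Y) ≡ elem v Y
elem-dedup v []       = refl
elem-dedup v (w ∷ ws) with elem w ws in w∈ws
... | true rewrite elem-dedup v ws with v == w in v==w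
...   | true  rewrite ==-sound v w v==w = w∈ws
...   | false = refl
elem-dedup v (w ∷ ws) | false rewrite elem-dedup v ws = refl

∑-dedup-point : ∀ v Y (G : List Step → ℤ) →
  ∑ (dedup Y) (λ w → if v == w then G w else + 0) ≡ (if elem v Y then G v else + 0)
∑-dedup-point v []       G = refl
∑-dedup-point v (w ∷ ws) G with elem w ws in w∈ws
... | true rewrite ∑-dedup-point v ws G with v == w in v==w
...   | true  rewrite ==-sound v w v==w | w∈ws = refl
...   | false = refl
∑-dedup-point v (w ∷ ws) G | false rewrite ∑-dedup-point v ws G with v == w in v==w
... | true  rewrite ==-sound v w v==w | w∈ws = ℤ.+-identityʳ _
... | false = ℤ.+-identityˡ _

-- Each w is counted through its preimages under f, of which there is exactly one unless G w = 0.
∑-dedup-reindex : ∀ {A : Set} Y (C : List A) (f : A → List Step) (G : List Step → ℤ) →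
  (∀ w → elem w Y ≡ true → G w ≡ ∑ C (λ c → if f c == w then G w else + 0)) →
  ∑ (dedup Y) G ≡ ∑ C (λ c → if elem (f c) Y then G (f c) else + 0)
∑-dedup-reindex Y C f G preimages = begin
  ∑ (dedup Y) G
    ≡⟨ ∑-cong (All.map (λ {w} w∈ → preimages w (trans (sym (elem-dedup w Y)) w∈)) (elem-members (dedup Y))) ⟩
  ∑ (dedup Y) (λ w → ∑ C (λ c → if f c == w then G w else + 0))
    ≡⟨ ∑-comm (dedup Y) C _ ⟩
  ∑ C (λ c → ∑ (dedup Y) (λ w → if f c == w then G w else + 0))
    ≡⟨ ∑-cong′ C (λ c → ∑-dedup-point (f c) Y G) ⟩
  ∑ C (λ c → if elem (f c) Y then G (f c) else + 0) ∎
  where open ≡-Reasoning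

inInterval : List Step → List Step → Bool
inInterval z w = isDyck w ∧ (UD ≼ w) ∧ not (w == z)

intervalTerm : List Step → List Step → ℤ
intervalTerm z w = if inInterval z w then μ̂ (decode w) else + 0

Bounded-refl : ∀ s → Bounded s (runsOf s)
Bounded-refl (pyramid _)        = _
Bounded-refl s@(twoPeaks _ _ _) = ≤ᴿ-refl (runsOf s)

inInterval-word : ∀ s t → inInterval (word s) (word t) ≡ not ⌊ t ≟ˢ s ⌋
inInterval-word s t rewrite word-dyck t | UD⊑word t | word-== t s = refl

inInterval-shape : ∀ s w → inInterval (word s) w ≡ true → w ⊑ word s →
  Σ Shape λ t → w ≡ word t × Bounded t (runsOf s) × length w < length (word s)
inInterval-shape s w inside w⊑s with ∧-true {isDyck w} inside
... | dyck , rest with ∧-true {UD ≼ w} rest | ⊑⇒≡∨length< w (word s) w⊑s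
... | _ , w≢s | inj₁ refl = ⊥-elim (true≢false (trans (sym w≢s) (cong not (==-refl w))))
... | _ , _   | inj₂ shorter with dyck-subword-shape (runsOf s) w dyck w⊑s
... | t , w≡t , bounded = t , w≡t , bounded , shorter

∑-support-indicator-self : ∀ s → ∑ (support s) (indicator s (μ̂ s)) ≡ μ̂ s
∑-support-indicator-self s with support-once s s (Bounded-refl s) (⊑-refl (word s))
... | inj₂ (once count) = count (μ̂ s)
... | inj₁ μ̂s≡0 rewrite μ̂s≡0 = ∑-if-zero (support s) (λ t → ⌊ t ≟ˢ s ⌋)

intervalTerm-preimages : ∀ s w → w ⊑ word s →
  intervalTerm (word s) w ≡ ∑ (support s) (λ c → if word c == w then intervalTerm (word s) w else + 0)
intervalTerm-preimages s w w⊑s with inInterval (word s) w in inside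
... | false = sym (∑-if-zero (support s) (λ c → word c == w))
... | true with inInterval-shape s w inside w⊑s
... | t , refl , bounded , _ rewrite decode-word t with support-once s t bounded w⊑s
... | inj₁ μ̂t≡0 rewrite μ̂t≡0 = sym (∑-if-zero (support s) (λ c → word c == word t))
... | inj₂ (once count) = sym (trans (∑-cong′ (support s) (λ c → if-cong (word-== c t))) (count (μ̂ t)))

∑-interval : ∀ s (F : List Step → ℤ) → s ≢ pyramid 0 →
  (∀ t → length (word t) < length (word s) → F (word t) ≡ μ̂ t) →
  ∑ (halfOpen UD (word s)) F ≡ - μ̂ s
∑-interval s F s≢UD F≡μ̂ = begin
  ∑ (halfOpen UD z) F
    ≡⟨ ∑-filterB (inInterval z) X F ⟩
  ∑ X (λ w → if inInterval z w then F w else + 0)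
    ≡⟨ ∑-cong (All.map (λ {w} → agree w) (elem-members X)) ⟩
  ∑ X (intervalTerm z)
    ≡⟨ ∑-dedup-reindex (subseqs z) (support s) word (intervalTerm z) preimages ⟩
  ∑ (support s) (λ c → if elem (word c) (subseqs z) then intervalTerm z (word c) else + 0)
    ≡⟨ ∑-cong (All.map (λ {c} → supportTerm {c}) (support-below s)) ⟩
  ∑ (support s) (λ c → μ̂ c +ℤ - indicator s (μ̂ s) c)
    ≡⟨ ∑-+ (support s) μ̂ (λ c → - indicator s (μ̂ s) c) ⟩
  ∑ (support s) μ̂ +ℤ ∑ (support s) (λ c → - indicator s (μ̂ s) c)
    ≡⟨ cong₂ _+ℤ_ (∑-support-μ̂ s s≢UD) (∑-neg (support s) (indicator s (μ̂ s))) ⟩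
  + 0 +ℤ - ∑ (support s) (indicator s (μ̂ s))
    ≡⟨ ℤ.+-identityˡ _ ⟩
  - ∑ (support s) (indicator s (μ̂ s))
    ≡⟨ cong -_ (∑-support-indicator-self s) ⟩
  - μ̂ s ∎
  where
  open ≡-Reasoning
  z : List Step
  z = word s
  X : List (List Step)
  X = dedup (subseqs z)
  ⊑z : ∀ {w} → elem w X ≡ true → w ⊑ z
  ⊑z {w} w∈X = trans (sym (elem-subseqs w z)) (trans (sym (elem-dedup w (subseqs z))) w∈X)
  agree : ∀ w → elem w X ≡ true → (if inInterval z w then F w else + 0) ≡ intervalTerm z w
  agree w w∈X with inInterval z w in inside
  ... | false = refl
  ... | true with inInterval-shape s w inside (⊑z w∈X)
  ... | t , refl , _ , shorter = trans (F≡μ̂ t shorter) (cong μ̂ (sym (decode-word t)))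
  preimages : ∀ w → elem w (subseqs z) ≡ true →
    intervalTerm z w ≡ ∑ (support s) (λ c → if word c == w then intervalTerm z w else + 0)
  preimages w w∈ = intervalTerm-preimages s w (trans (sym (elem-subseqs w z)) w∈)
  supportTerm : ∀ {c} → word c ⊑ z →
    (if elem (word c) (subseqs z) then intervalTerm z (word c) else + 0) ≡ μ̂ c +ℤ - indicator s (μ̂ s) c
  supportTerm {c} c⊑z rewrite elem-subseqs (word c) z | c⊑z | inInterval-word s c | decode-word c with c ≟ˢ s
  ... | yes refl = sym (ℤ.+-inverseʳ (μ̂ c))
  ... | no  _    = sym (ℤ.+-identityʳ (μ̂ c))

μ-fuel-step : ∀ n s → s ≢ pyramid 0 → length (word s) < suc n →
  (∀ t → length (word t) < n → μ-fuel n UD (word t) ≡ μ̂ t) → μ-fuel (suc n) UD (word s) ≡ μ̂ s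
μ-fuel-step n s s≢UD shorter ih
  rewrite word-== (pyramid 0) s | ≟ˢ-≢ (pyramid 0) s (≢-sym s≢UD) | UD⊑word s =
  trans (cong -_ (∑-interval s (μ-fuel n UD) s≢UD (λ t t<s → ih t (ℕ.<-≤-trans t<s (ℕ.≤-pred shorter)))))
        (ℤ.neg-involutive (μ̂ s))

μ-fuel-word : ∀ n s → length (word s) < n → μ-fuel n UD (word s) ≡ μ̂ s
μ-fuel-word (suc n) (pyramid zero)        _       = refl
μ-fuel-word (suc n) s@(pyramid (suc _))   shorter = μ-fuel-step n s (λ ()) shorter (μ-fuel-word n)
μ-fuel-word (suc n) s@(twoPeaks _ _ _)    shorter = μ-fuel-step n s (λ ()) shorter (μ-fuel-word n)

μ-UD-word : ∀ s → μ UD (word s) ≡ μ̂ s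
μ-UD-word s = μ-fuel-word (suc (length (word s))) s ℕ.≤-refl

Δφ-superdiag : ∀ a → Δφ a (a + 1) ≡ + 1
Δφ-superdiag a
  rewrite ℕ.+-comm a 1
        | φ-off (suc a) (2 + a) (ℕ.<⇒≢ (ℕ.n<1+n (suc a)))
        | φ-off a (2 + a) (ℕ.<⇒≢ (ℕ.m<n+m a (s≤s z≤n)))
        | φ-diag a
        | φ-off a (suc a) (ℕ.<⇒≢ (ℕ.n<1+n a)) = refl

Δφ-diag : ∀ a → Δφ (suc a) (suc a) ≡ - + 2
Δφ-diag a
  rewrite φ-diag a
        | φ-off (suc a) (2 + a) (ℕ.<⇒≢ (ℕ.n<1+n (suc a)))
        | φ-off (2 + a) (suc a) (ℕ.>⇒≢ (ℕ.n<1+n (suc a))) = refl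

mainTheorem11 : (∀ (a : ℕ) → a ≥ 1 → μ UD (Q a (a + 1) 1) ≡ - (+ 1))
    × (∀ (a : ℕ) → a ≥ 1 → μ UD (Q a (a + 1) 0) ≡ + 1)
    × ((∀ (a : ℕ) → a ≥ 2 → μ UD (Q a a 0) ≡ - (+ 2)) × μ UD (Q 1 1 0) ≡ - (+ 1))
    × ((∀ (a : ℕ) → a ≥ 2 → μ UD (Q a a 1) ≡ + 2) × μ UD (Q 1 1 1) ≡ + 1)
mainTheorem11 =
  superdiagonal₁ , superdiagonal₀ , (diagonal₀ , μ-UD-word (twoPeaks 0 0 0)) , (diagonal₁ , μ-UD-word (twoPeaks 0 0 1))
  where
  superdiagonal₁ : ∀ a → a ≥ 1 → μ UD (Q a (a + 1) 1) ≡ - (+ 1)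
  superdiagonal₁ (suc a) _ = trans (μ-UD-word (twoPeaks a (a + 1) 1)) (cong -_ (Δφ-superdiag a))
  superdiagonal₀ : ∀ a → a ≥ 1 → μ UD (Q a (a + 1) 0) ≡ + 1
  superdiagonal₀ (suc a) _ = trans (μ-UD-word (twoPeaks a (a + 1) 0)) (Δφ-superdiag a)
  diagonal₀ : ∀ a → a ≥ 2 → μ UD (Q a a 0) ≡ - (+ 2)
  diagonal₀ 1             (s≤s ())
  diagonal₀ (suc (suc a)) _ = trans (μ-UD-word (twoPeaks (suc a) (suc a) 0)) (Δφ-diag a)
  diagonal₁ : ∀ a → a ≥ 2 → μ UD (Q a a 1) ≡ + 2
  diagonal₁ 1             (s≤s ())
  diagonal₁ (suc (suc a)) _ = trans (μ-UD-word (twoPeaks (suc a) (suc a) 1)) (cong -_ (Δφ-diag a))
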